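{- Let $T$ be a tournament on $n$ vertices whose minimum feedback arc set has size $k$, and let $\pi$ be a linear ordering of its vertices (positions $0,\dots,n-1$) with exactly $k$ backward arcs. Let $t>0$ and $d>0$ be real numbers with $d \ge 4t$ and $t \ge \sqrt{k}$. Let $D_\pi$ be the set of vertices $v$ whose error $|\pi(v) - \mathrm{indeg}(v)|$ is more than $d$, and let $B$ be the set of bad vertices of $T$ with respect to $t$. Then $D_\pi \subseteq B$.
   Context: A tournament is a directed graph in which every pair of distinct vertices is joined by exactly one arc. A feedback arc set is a set of arcs whose removal leaves an acyclic digraph. In a linear ordering $\pi$ of the vertices, an arc $(u,v)$ (directed from $u$ to $v$) is backward if $\pi(v) < \pi(u)$; $\pi(v)$ denotes the position of $v$ and $\mathrm{indeg}(v)$ the number of arcs directed into $v$. Three vertices form a triangle if the three arcs among them form a directed cycle. An arc is a major suspect if it belongs to at least $t$ triangles. A vertex is bad if at least $t$ arcs incident with it are major suspects.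
   Formalization: The parameters t and d range over the rationals instead of the reals. -}

module Defs where

open import Data.Bool using (Bool; true; false; _∧_; _∨_; not; if_then_else_)
open import Data.Nat using (ℕ; zero; suc; _+_; ∣_-_∣; _≤_)
open import Data.Fin using (Fin; zero; suc; toℕ; inject₁; fromℕ)
open import Data.Fin.Permutation using (Permutation′; _⟨$⟩ʳ_)
open import Data.Integer using (+_)
open import Data.Rational using (ℚ; _/_; _≤ᵇ_)
import Data.Rational as Q
open import Data.Product using (Σ; _×_)
open import Data.Sum using (_⊎_)
open import Relation.Binary.PropositionalEquality using (_≡_; _≢_)
open import Relation.Nullary.Decidable using (⌊_⌋)
open import Data.Fin.Properties using (_<?_)

ℕtoℚ : ℕ → ℚ
ℕtoℚ n = (+ n) / 1

count : ∀ {n} → (Fin n → Bool) → ℕ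
count {zero} p = 0
count {suc n} p = (if p zero then 1 else 0) + count (λ i → p (suc i))

sumFin : ∀ {n} → (Fin n → ℕ) → ℕ
sumFin {zero} f = 0
sumFin {suc n} f = f zero + sumFin (λ i → f (suc i))

count₂ : ∀ {n} → (Fin n → Fin n → Bool) → ℕ
count₂ p = sumFin (λ u → count (p u))

Digraph : ℕ → Set
Digraph n = Fin n → Fin n → Bool

record Tournament (n : ℕ) : Set where
  field
    arc      : Digraph n
    loopless : ∀ v → arc v v ≡ false
    total    : ∀ u v → u ≢ v → (arc u v ≡ true) ⊎ (arc v u ≡ true)
    antisym  : ∀ u v → arc u v ≡ true → arc v u ≡ false

-- A directed closed walk of length m+1: vertices p 0, ..., p (m+1) with
-- arcs p i → p (i+1) and p (m+1) = p 0.  A digraph is acyclic iff it has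
-- no directed cycle, equivalently no directed closed walk of positive length.
Acyclic : ∀ {n} → Digraph n → Set
Acyclic {n} G = ∀ (m : ℕ) (p : Fin (suc (suc m)) → Fin n)
  → (∀ (i : Fin (suc m)) → G (p (inject₁ i)) (p (suc i)) ≡ true)
  → p (fromℕ (suc m)) ≢ p zero

IsArcSubset : ∀ {n} → Digraph n → (Fin n → Fin n → Bool) → Set
IsArcSubset G F = ∀ u v → F u v ≡ true → G u v ≡ true

removeArcs : ∀ {n} → Digraph n → (Fin n → Fin n → Bool) → Digraph n
removeArcs G F u v = G u v ∧ not (F u v)

IsFeedbackArcSet : ∀ {n} → Digraph n → (Fin n → Fin n → Bool) → Set
IsFeedbackArcSet G F = IsArcSubset G F × Acyclic (removeArcs G F)

MinFASSize : ∀ {n} → Digraph n → ℕ → Set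
MinFASSize {n} G k =
  Σ (Fin n → Fin n → Bool) (λ F → IsFeedbackArcSet G F × count₂ F ≡ k)
  × (∀ F → IsFeedbackArcSet G F → k ≤ count₂ F)

-- linear ordering of the vertices: π ⟨$⟩ʳ v is the position of v (0..n-1)
Ordering : ℕ → Set
Ordering n = Permutation′ n

backwardCount : ∀ {n} → Digraph n → Ordering n → ℕ
backwardCount G π = count₂ (λ u v → G u v ∧ ⌊ (π ⟨$⟩ʳ v) <? (π ⟨$⟩ʳ u) ⌋)

indeg : ∀ {n} → Digraph n → Fin n → ℕ
indeg G v = count (λ u → G u v)

err : ∀ {n} → Digraph n → Ordering n → Fin n → ℕ
err G π v = ∣ toℕ (π ⟨$⟩ʳ v) - indeg G v ∣

triangles : ∀ {n} → Digraph n → Fin n → Fin n → ℕ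
triangles G u v = count (λ w → G v w ∧ G w u)

majorSuspect : ∀ {n} → Digraph n → ℚ → Fin n → Fin n → Bool
majorSuspect G t u v = G u v ∧ (t ≤ᵇ ℕtoℚ (triangles G u v))

suspectDeg : ∀ {n} → Digraph n → ℚ → Fin n → ℕ
suspectDeg G t v = count (λ w → majorSuspect G t v w ∨ majorSuspect G t w v)

Bad : ∀ {n} → Digraph n → ℚ → Fin n → Set
Bad G t v = t Q.≤ ℕtoℚ (suspectDeg G t v)

{-# OPTIONS --safe #-}
module Submission where

-- Let e be the integer with e < t ≤ e + 1, so that k ≤ (e + 1)² and err v > 4e. The error
-- of v is |a − b|, where b counts the backward arcs entering v and a those leaving it;
-- reversing both the tournament and the ordering exchanges a and b, so say b > 4e.
-- For each of the b in-neighbours u of v placed after v, moving v just behind u makes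
-- forward the backward arcs from the in-neighbours of v up to u, and makes backward the
-- arcs from v to its out-neighbours up to u; as the ordering is optimal, the latter are at
-- least as many. Each such out-neighbour w either closes a triangle v → w → u → v or
-- yields a backward arc u → w. Summed over u, the numbers of in-neighbours up to u add up
-- to b(b + 1)/2, while the backward arcs leaving the vertices u, together with the b arcs
-- into v, number at most k ≤ (e + 1)². If no more than e of the arcs u → v lay on more
-- than e triangles, this would give b(b + 1)/2 ≤ 2eb − e² + (e + 1)² − b, which fails for
-- b > 4e. Hence more than e, that is at least t, arcs at v are major suspects.

open import Defs

module Counting where

  open import Data.Bool using (Bool; true; false; _∧_; _∨_; not; if_then_else_)
  open import Data.Bool.Properties using (∧-conicalˡ; ∧-conicalʳ; ∧-zeroʳ; ∧-comm; ∨-zeroʳ; T-≡)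
  open import Data.Nat
    using (ℕ; zero; suc; _+_; _*_; _∸_; ∣_-_∣; _≤_; _<_; z≤n; s≤s; s≤s⁻¹; _≤?_; _<?_)
  open import Data.Nat.Properties hiding (_≟_)
  open import Data.Nat.Tactic.RingSolver using (solve-∀)
  open import Data.Fin using (Fin; zero; suc; toℕ; _≟_; inject₁; fromℕ)
  import Data.Fin.Properties as Fin
  open import Data.Fin.Permutation using (_⟨$⟩ʳ_; _⟨$⟩ˡ_; inverseˡ)
  import Data.Rational as ℚ
  import Data.Rational.Properties as ℚ
  open import Data.Product using (_,_; proj₂)
  open import Data.Sum using (_⊎_; inj₁; inj₂; swap)
  open import Data.Empty using (⊥; ⊥-elim)
  open import Function using (_∘_; Equivalence)
  open import Relation.Binary.Definitions using (Transitive; Irreflexive)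
  open import Relation.Binary.PropositionalEquality
  open import Relation.Nullary.Decidable using (Dec; ⌊_⌋; yes; no; isYes≗does; dec-true; dec-false)
  open import Relation.Nullary.Negation using (¬_; contradiction)
  open import Algebra.Properties.Semiring.Sum +-*-semiring
    using ( sum; sum-syntax; sum-cong-≗; sum-replicate-zero; ∑-distrib-+; ∑-comm; ∑-permute
          ; *-distribˡ-sum; *-distribʳ-sum)

  ⟦_⟧ : Bool → ℕ
  ⟦ b ⟧ = if b then 1 else 0

  ⌊⌋-true : ∀ {a} {A : Set a} (a? : Dec A) → A → ⌊ a? ⌋ ≡ true
  ⌊⌋-true a? a = trans (isYes≗does a?) (dec-true a? a)

  ⌊⌋-false : ∀ {a} {A : Set a} (a? : Dec A) → ¬ A → ⌊ a? ⌋ ≡ false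
  ⌊⌋-false a? ¬a = trans (isYes≗does a?) (dec-false a? ¬a)

  ⌊⌋-sound : ∀ {a} {A : Set a} (a? : Dec A) → ⌊ a? ⌋ ≡ true → A
  ⌊⌋-sound (yes a) _ = a

  ⟦⟧-mono : ∀ {a b} → (a ≡ true → b ≡ true) → ⟦ a ⟧ ≤ ⟦ b ⟧
  ⟦⟧-mono {false} _   = z≤n
  ⟦⟧-mono {true}  a⇒b rewrite a⇒b refl = ≤-refl

  ⟦⟧-mono-⊎ : ∀ {a b c} → (a ≡ true → b ≡ true ⊎ c ≡ true) → ⟦ a ⟧ ≤ ⟦ b ⟧ + ⟦ c ⟧
  ⟦⟧-mono-⊎ {false} _ = z≤n
  ⟦⟧-mono-⊎ {true} {b} a⇒b⊎c with a⇒b⊎c refl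
  ... | inj₁ refl = s≤s z≤n
  ... | inj₂ refl = m≤n+m 1 ⟦ b ⟧

  ⟦⟧-split : ∀ a c → ⟦ a ⟧ ≡ ⟦ a ∧ not c ⟧ + ⟦ c ∧ a ⟧
  ⟦⟧-split false c     rewrite ∧-zeroʳ c = refl
  ⟦⟧-split true  false = refl
  ⟦⟧-split true  true  = refl

  ⟦<⟧+⟦>⟧≡1 : ∀ {a b} → a ≢ b → ⟦ ⌊ a <? b ⌋ ⟧ + ⟦ ⌊ b <? a ⌋ ⟧ ≡ 1
  ⟦<⟧+⟦>⟧≡1 {a} {b} a≢b with a <? b | b <? a
  ... | yes a<b | yes b<a = contradiction a<b (<-asym b<a)
  ... | yes _   | no _    = refl
  ... | no _    | yes _   = refl
  ... | no a≮b  | no b≮a  = contradiction (≤-antisym (≮⇒≥ b≮a) (≮⇒≥ a≮b)) a≢b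

  ⌊⌋-⇔ : ∀ {a b} {A : Set a} {B : Set b} (a? : Dec A) (b? : Dec B) →
    (A → B) → (B → A) → ⌊ a? ⌋ ≡ ⌊ b? ⌋
  ⌊⌋-⇔ (yes a) b? to from = sym (⌊⌋-true b? (to a))
  ⌊⌋-⇔ (no ¬a) b? to from = sym (⌊⌋-false b? (¬a ∘ from))

  ⌊2*≤2*⌋ : ∀ a b → ⌊ 2 * a ≤? 2 * b ⌋ ≡ ⌊ a ≤? b ⌋
  ⌊2*≤2*⌋ a b = ⌊⌋-⇔ (2 * a ≤? 2 * b) (a ≤? b) (*-cancelˡ-≤ 2) (*-monoʳ-≤ 2)

  ⌊2*≤1+2*⌋ : ∀ a b → ⌊ 2 * a ≤? suc (2 * b) ⌋ ≡ ⌊ a ≤? b ⌋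
  ⌊2*≤1+2*⌋ a b = ⌊⌋-⇔ (2 * a ≤? suc (2 * b)) (a ≤? b)
    (λ 2a≤1+2b → m<1+n⇒m≤n (*-cancelˡ-< 2 a (suc b)
                   (≤-trans (s≤s 2a≤1+2b) (≤-reflexive (sym (*-suc 2 b))))))
    (λ a≤b → m≤n⇒m≤1+n (*-monoʳ-≤ 2 a≤b))

  ⌊1+2*≤2*⌋ : ∀ a b → ⌊ suc (2 * a) ≤? 2 * b ⌋ ≡ ⌊ a <? b ⌋
  ⌊1+2*≤2*⌋ a b = ⌊⌋-⇔ (suc (2 * a) ≤? 2 * b) (a <? b)
    (*-cancelˡ-< 2 a b)
    (λ a<b → <⇒≤ (≤-trans (≤-reflexive (sym (*-suc 2 a))) (*-monoʳ-≤ 2 a<b)))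

  ⟦≤⟧+⟦between⟧ : ∀ {p q} a → p ≤ q →
    ⟦ ⌊ a ≤? p ⌋ ⟧ + ⟦ ⌊ p <? a ⌋ ∧ ⌊ a ≤? q ⌋ ⟧ ≡ ⟦ ⌊ a ≤? q ⌋ ⟧
  ⟦≤⟧+⟦between⟧ {p} {q} a p≤q with a ≤? p | p <? a | a ≤? q
  ... | yes a≤p | yes p<a | _       = contradiction p<a (≤⇒≯ a≤p)
  ... | yes _   | no _    | yes _   = refl
  ... | yes a≤p | no _    | no a≰q  = contradiction (≤-trans a≤p p≤q) a≰q
  ... | no _    | yes _   | yes _   = refl
  ... | no _    | yes _   | no _    = refl
  ... | no a≰p  | no p≮a  | _       = contradiction (≮⇒≥ p≮a) a≰p

  ⟦≤⟧≡⟦>⟧+⟦between⟧ : ∀ {p q} a → a ≢ p → p ≤ q →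
    ⟦ ⌊ p ≤? a ⌋ ⟧ ≡ ⟦ ⌊ q <? a ⌋ ⟧ + ⟦ ⌊ p <? a ⌋ ∧ ⌊ a ≤? q ⌋ ⟧
  ⟦≤⟧≡⟦>⟧+⟦between⟧ {p} {q} a a≢p p≤q with p <? a | q <? a | a ≤? q
  ... | yes _   | yes q<a | yes a≤q = contradiction a≤q (<⇒≱ q<a)
  ... | yes p<a | yes _   | no _    = cong ⟦_⟧ (⌊⌋-true (p ≤? a) (<⇒≤ p<a))
  ... | yes p<a | no _    | yes _   = cong ⟦_⟧ (⌊⌋-true (p ≤? a) (<⇒≤ p<a))
  ... | yes _   | no q≮a  | no a≰q  = contradiction (≮⇒≥ q≮a) a≰q
  ... | no p≮a  | yes q<a | _       = contradiction (≤-<-trans p≤q q<a) p≮a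
  ... | no p≮a  | no _    | _       =
    cong ⟦_⟧ (⌊⌋-false (p ≤? a) λ p≤a → p≮a (≤∧≢⇒< p≤a (a≢p ∘ sym)))

  ⟦≤⟧+⟦≥⟧≡1 : ∀ {a b} → a ≢ b → ⟦ ⌊ a ≤? b ⌋ ⟧ + ⟦ ⌊ b ≤? a ⌋ ⟧ ≡ 1
  ⟦≤⟧+⟦≥⟧≡1 {a} {b} a≢b with a ≤? b | b ≤? a
  ... | yes a≤b | yes b≤a = contradiction (≤-antisym a≤b b≤a) a≢b
  ... | yes _   | no _    = refl
  ... | no _    | yes _   = refl
  ... | no a≰b  | no b≰a  = contradiction (≰⇒≥ b≰a) a≰b

  sumFin≡sum : ∀ {n} (f : Fin n → ℕ) → sumFin f ≡ sum f
  sumFin≡sum {zero}  f = refl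
  sumFin≡sum {suc n} f = cong (f zero +_) (sumFin≡sum (f ∘ suc))

  count≡sum : ∀ {n} (p : Fin n → Bool) → count p ≡ ∑[ i < n ] ⟦ p i ⟧
  count≡sum {zero}  p = refl
  count≡sum {suc n} p = cong (⟦ p zero ⟧ +_) (count≡sum (p ∘ suc))

  sum₂ : ∀ {n} → (Fin n → Fin n → ℕ) → ℕ
  sum₂ {n} f = ∑[ x < n ] ∑[ y < n ] f x y

  count₂≡sum₂ : ∀ {n} (F : Fin n → Fin n → Bool) → count₂ F ≡ sum₂ (λ x y → ⟦ F x y ⟧)
  count₂≡sum₂ F = trans (sumFin≡sum (count ∘ F)) (sum-cong-≗ (count≡sum ∘ F))

  sum-mono-≤ : ∀ {n} {f g : Fin n → ℕ} → (∀ i → f i ≤ g i) → sum f ≤ sum g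
  sum-mono-≤ {zero}  f≤g = z≤n
  sum-mono-≤ {suc n} f≤g = +-mono-≤ (f≤g zero) (sum-mono-≤ (f≤g ∘ suc))

  sum₂-distrib-+ : ∀ {n} (f g : Fin n → Fin n → ℕ) →
    sum₂ (λ x y → f x y + g x y) ≡ sum₂ f + sum₂ g
  sum₂-distrib-+ f g =
    trans (sum-cong-≗ λ x → ∑-distrib-+ (f x) (g x)) (∑-distrib-+ (sum ∘ f) (sum ∘ g))

  sum-zero : ∀ {n} {f : Fin n → ℕ} → (∀ i → f i ≡ 0) → sum f ≡ 0
  sum-zero {n} f≡0 = trans (sum-cong-≗ f≡0) (sum-replicate-zero n)

  sum-δ : ∀ {n} (f : Fin n → ℕ) (j : Fin n) → (∀ i → i ≢ j → f i ≡ 0) → sum f ≡ f j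
  sum-δ {suc n} f zero    f≡0 =
    trans (cong (f zero +_) (sum-zero λ i → f≡0 (suc i) λ ())) (+-identityʳ _)
  sum-δ {suc n} f (suc j) f≡0 =
    cong₂ _+_ (f≡0 zero λ ())
              (sum-δ (f ∘ suc) j λ i i≢j → f≡0 (suc i) (i≢j ∘ Fin.suc-injective))

  sum-δ-∧ : ∀ {n} (b : Fin n → Bool) (j : Fin n) → ∑[ i < n ] ⟦ ⌊ i ≟ j ⌋ ∧ b i ⟧ ≡ ⟦ b j ⟧
  sum-δ-∧ b j =
    trans (sum-δ _ j (λ i i≢j → cong (λ c → ⟦ c ∧ b i ⟧) (⌊⌋-false (i ≟ j) i≢j)))
          (cong (λ c → ⟦ c ∧ b j ⟧) (⌊⌋-true (j ≟ j) refl))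

  sum₂-δ-row : ∀ {n} (b : Fin n → Bool) (j : Fin n) →
    sum₂ (λ x y → ⟦ ⌊ x ≟ j ⌋ ∧ b y ⟧) ≡ ∑[ y < n ] ⟦ b y ⟧
  sum₂-δ-row b j =
    trans (∑-comm (λ x y → ⟦ ⌊ x ≟ j ⌋ ∧ b y ⟧)) (sum-cong-≗ λ y → sum-δ-∧ (λ _ → b y) j)

  sum₂-δ-column : ∀ {n} (b : Fin n → Bool) (j : Fin n) →
    sum₂ (λ x y → ⟦ ⌊ y ≟ j ⌋ ∧ b x ⟧) ≡ ∑[ x < n ] ⟦ b x ⟧
  sum₂-δ-column b j = sum-cong-≗ λ x → sum-δ-∧ (λ _ → b x) j

  sum-remove-one : ∀ {n} (b : Fin n → Bool) (j : Fin n) →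
    ∑[ i < n ] ⟦ b i ⟧ ≡ ∑[ i < n ] ⟦ b i ∧ not ⌊ i ≟ j ⌋ ⟧ + ⟦ b j ⟧
  sum-remove-one {n} b j = begin
    ∑[ i < n ] ⟦ b i ⟧                                ≡⟨ sum-cong-≗ (λ i → ⟦⟧-split (b i) ⌊ i ≟ j ⌋) ⟩
    ∑[ i < n ] (others i + ⟦ ⌊ i ≟ j ⌋ ∧ b i ⟧)       ≡⟨ ∑-distrib-+ others (λ i → ⟦ ⌊ i ≟ j ⌋ ∧ b i ⟧) ⟩
    sum others + ∑[ i < n ] ⟦ ⌊ i ≟ j ⌋ ∧ b i ⟧       ≡⟨ cong (sum others +_) (sum-δ-∧ b j) ⟩
    sum others + ⟦ b j ⟧                              ∎
    where
    open ≡-Reasoning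
    others : Fin n → ℕ
    others i = ⟦ b i ∧ not ⌊ i ≟ j ⌋ ⟧

  count₂-transpose : ∀ {n} (F : Fin n → Fin n → Bool) → count₂ (λ x y → F y x) ≡ count₂ F
  count₂-transpose F =
    trans (count₂≡sum₂ (λ x y → F y x)) (trans (∑-comm (λ x y → ⟦ F y x ⟧)) (sym (count₂≡sum₂ F)))

  count₂-mono : ∀ {n} {F F′ : Fin n → Fin n → Bool} →
    (∀ x y → F x y ≡ true → F′ x y ≡ true) → count₂ F ≤ count₂ F′
  count₂-mono {F = F} {F′} F⇒F′ = subst₂ _≤_ (sym (count₂≡sum₂ F)) (sym (count₂≡sum₂ F′))
    (sum-mono-≤ λ x → sum-mono-≤ λ y → ⟦⟧-mono (F⇒F′ x y))

  -- X counts each pair {u, w} of distinct elements of S once, and each element of S once.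
  sum-ordered-pairs : ∀ {n} (S : Fin n → Bool) (P : Fin n → ℕ) → (∀ {x y} → P x ≡ P y → x ≡ y) →
    let m = ∑[ u < n ] ⟦ S u ⟧
        X = ∑[ u < n ] (⟦ S u ⟧ * ∑[ w < n ] ⟦ S w ∧ ⌊ P w ≤? P u ⌋ ⟧)
    in X + X ≡ m * m + m
  sum-ordered-pairs {n} S P P-injective = begin
    X + X                                  ≡⟨ cong₂ _+_ X≡sum₂ (trans X≡sum₂ (∑-comm h)) ⟩
    sum₂ h + sum₂ (λ u w → h w u)          ≡⟨ sum₂-distrib-+ h (λ u w → h w u) ⟨
    sum₂ (λ u w → h u w + h w u)           ≡⟨ sum-cong-≗ (λ u → sum-cong-≗ (symmetrise u)) ⟩
    sum₂ (λ u w → ⟦ S u ⟧ * ⟦ S w ⟧ + ⟦ ⌊ w ≟ u ⌋ ∧ S w ⟧)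
      ≡⟨ sum₂-distrib-+ (λ u w → ⟦ S u ⟧ * ⟦ S w ⟧) (λ u w → ⟦ ⌊ w ≟ u ⌋ ∧ S w ⟧) ⟩
    sum₂ (λ u w → ⟦ S u ⟧ * ⟦ S w ⟧) + sum₂ (λ u w → ⟦ ⌊ w ≟ u ⌋ ∧ S w ⟧)
      ≡⟨ cong₂ _+_ squares (sum-cong-≗ (sum-δ-∧ S)) ⟩
    m * m + m                              ∎
    where
    open ≡-Reasoning
    m X : ℕ
    m = ∑[ u < n ] ⟦ S u ⟧
    X = ∑[ u < n ] (⟦ S u ⟧ * ∑[ w < n ] ⟦ S w ∧ ⌊ P w ≤? P u ⌋ ⟧)
    h : Fin n → Fin n → ℕ
    h u w = ⟦ S u ⟧ * ⟦ S w ∧ ⌊ P w ≤? P u ⌋ ⟧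
    X≡sum₂ : X ≡ sum₂ h
    X≡sum₂ = sum-cong-≗ (λ u → *-distribˡ-sum ⟦ S u ⟧ (λ w → ⟦ S w ∧ ⌊ P w ≤? P u ⌋ ⟧))
    squares : sum₂ (λ u w → ⟦ S u ⟧ * ⟦ S w ⟧) ≡ m * m
    squares = trans (sum-cong-≗ (λ u → sym (*-distribˡ-sum ⟦ S u ⟧ (λ w → ⟦ S w ⟧))))
                    (sym (*-distribʳ-sum m (λ u → ⟦ S u ⟧)))
    symmetrise : ∀ u w → h u w + h w u ≡ ⟦ S u ⟧ * ⟦ S w ⟧ + ⟦ ⌊ w ≟ u ⌋ ∧ S w ⟧
    symmetrise u w with S u in Su | S w in Sw | w ≟ u
    ... | false | false | w≟u       rewrite ∧-zeroʳ ⌊ w≟u ⌋ = refl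
    ... | false | true  | yes refl  with () ← trans (sym Sw) Su
    ... | false | true  | no _      = refl
    ... | true  | false | w≟u       rewrite ∧-zeroʳ ⌊ w≟u ⌋ = refl
    ... | true  | true  | yes refl  rewrite ⌊⌋-true (P u ≤? P u) ≤-refl = refl
    ... | true  | true  | no w≢u
      rewrite *-identityˡ ⟦ ⌊ P w ≤? P u ⌋ ⟧ | *-identityˡ ⟦ ⌊ P u ≤? P w ⌋ ⟧ =
        ⟦≤⟧+⟦≥⟧≡1 (w≢u ∘ P-injective)

  backArcs : ∀ {n} → Digraph n → (Fin n → ℕ) → Fin n → Fin n → Bool
  backArcs G r x y = G x y ∧ ⌊ r y ≤? r x ⌋

  forwardArcs : ∀ {n} → Digraph n → (Fin n → ℕ) → Fin n → Fin n → Bool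
  forwardArcs G r x y = G x y ∧ ⌊ r x ≤? r y ⌋

  module _ {n} {H : Digraph n} {_≺_ : ℕ → ℕ → Set} (≺-trans : Transitive _≺_)
           (r : Fin n → ℕ) (increasing : ∀ {x y} → H x y ≡ true → r x ≺ r y) where

    closedWalk-increasing : ∀ m (p : Fin (suc (suc m)) → Fin n) →
      (∀ i → H (p (inject₁ i)) (p (suc i)) ≡ true) → r (p zero) ≺ r (p (fromℕ (suc m)))
    closedWalk-increasing zero    p arcs = increasing (arcs zero)
    closedWalk-increasing (suc m) p arcs =
      ≺-trans (closedWalk-increasing m (p ∘ inject₁) (arcs ∘ inject₁))
              (increasing (arcs (fromℕ (suc m))))

    acyclic-if-increasing : Irreflexive _≡_ _≺_ → Acyclic H
    acyclic-if-increasing ≺-irrefl m p arcs closed =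
      ≺-irrefl (cong r (sym closed)) (closedWalk-increasing m p arcs)

  backArcs-isFAS : ∀ {n} (G : Digraph n) r → IsFeedbackArcSet G (backArcs G r)
  backArcs-isFAS G r =
    (λ x y → ∧-conicalˡ _ _) , acyclic-if-increasing <-trans r kept-increasing <-irrefl
    where
    kept-increasing : ∀ {x y} → removeArcs G (backArcs G r) x y ≡ true → r x < r y
    kept-increasing {x} {y} h with G x y | r y ≤? r x
    ... | true | no ry≰rx = ≰⇒> ry≰rx

  forwardArcs-isFAS : ∀ {n} (G : Digraph n) r → IsFeedbackArcSet G (forwardArcs G r)
  forwardArcs-isFAS G r =
    (λ x y → ∧-conicalˡ _ _) ,
    acyclic-if-increasing (λ y<x z<y → <-trans z<y y<x) r kept-decreasing (<-irrefl ∘ sym)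
    where
    kept-decreasing : ∀ {x y} → removeArcs G (forwardArcs G r) x y ≡ true → r y < r x
    kept-decreasing {x} {y} h with G x y | r x ≤? r y
    ... | true | no rx≰ry = ≰⇒> rx≰ry

  module _ {n} {G : Digraph n} {k} (min : MinFASSize G k) (r : Fin n → ℕ) where

    minFAS≤backArcs : k ≤ count₂ (backArcs G r)
    minFAS≤backArcs = proj₂ min _ (backArcs-isFAS G r)

    minFAS≤forwardArcs : k ≤ count₂ (forwardArcs G r)
    minFAS≤forwardArcs = proj₂ min _ (forwardArcs-isFAS G r)

  -- Adding each inequality to itself and substituting X + X leaves a left side that exceeds
  -- the right one by 2 + gap.
  quadratic-contradiction : ∀ X s h g W → let e = s + h ; b = suc (4 * e + g) in
    X + X ≡ b * b + b → X + s * e ≤ s * b + b * e + W → W + b ≤ suc e * suc e → ⊥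
  quadratic-contradiction X s h g W X+X≡ repaired≤ back≤ = <-irrefl refl (begin-strict
    R                                                ≤⟨ m≤m+n R (suc gap) ⟩
    R + suc gap                                      <⟨ n<1+n _ ⟩
    suc (R + suc gap)                                ≡⟨ excess s h g W ⟩
    b * b + b + rest                                 ≡⟨ cong (_+ rest) X+X≡ ⟨
    X + X + rest                                     ≡⟨ regroup X (s * e) W b ⟩
    (X + s * e) + (X + s * e) + ((W + b) + (W + b))
      ≤⟨ +-mono-≤ (+-mono-≤ repaired≤ repaired≤) (+-mono-≤ back≤ back≤) ⟩
    R                                                ∎)
    where
    open ≤-Reasoning
    e b R gap rest : ℕ
    e = s + h
    b = suc (4 * e + g)
    R = (s * b + b * e + W) + (s * b + b * e + W) + (suc e * suc e + suc e * suc e)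
    gap = 2 * h * (3 * e + 1 + g) + 12 * e + 4 * g + g * b
    rest = s * e + s * e + (W + b) + (W + b)
    regroup : ∀ x y w c →
      x + x + (y + y + (w + c) + (w + c)) ≡ (x + y) + (x + y) + ((w + c) + (w + c))
    regroup = solve-∀
    excess : ∀ s h g W → let e = s + h ; b = suc (4 * e + g) in
      suc ((s * b + b * e + W) + (s * b + b * e + W) + (suc e * suc e + suc e * suc e)
           + suc (2 * h * (3 * e + 1 + g) + 12 * e + 4 * g + g * b))
      ≡ b * b + b + (s * e + s * e + (W + b) + (W + b))
    excess = solve-∀

  suspects-exceed : ∀ {X s b e W} → X + X ≡ b * b + b → X + s * e ≤ s * b + b * e + W →
    W + b ≤ suc e * suc e → 4 * e < b → e < s
  suspects-exceed {X} {s} {b} {e} {W} X+X≡ repaired≤ back≤ 4e<b with s ≤? e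
  ... | no s≰e = ≰⇒> s≰e
  ... | yes s≤e with m≤n⇒∃[o]m+o≡n s≤e | m≤n⇒∃[o]m+o≡n 4e<b
  ...   | h , refl | g , refl = ⊥-elim (quadratic-contradiction X s h g W X+X≡ repaired≤ back≤)

  ∸-reverse-≤ : ∀ {n a b} → a ≤ n → a ≢ b → n ∸ b ≤ n ∸ a → a < b
  ∸-reverse-≤ {n} {a} {b} a≤n a≢b n∸b≤n∸a with a <? b
  ... | yes a<b = a<b
  ... | no a≮b  =
    contradiction n∸b≤n∸a (<⇒≱ (∸-monoʳ-< (≤∧≢⇒< (≮⇒≥ a≮b) (a≢b ∘ sym)) a≤n))

  <∣-∣⇒<⊎< : ∀ {m a b} → m < ∣ a - b ∣ → m < a ⊎ m < b
  <∣-∣⇒<⊎< {m} {a} {b} m<∣a-b∣ with ⊔-sel a b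
  ... | inj₁ a⊔b≡a = inj₁ (subst (m <_) a⊔b≡a (<-≤-trans m<∣a-b∣ (∣m-n∣≤m⊔n a b)))
  ... | inj₂ a⊔b≡b = inj₂ (subst (m <_) a⊔b≡b (<-≤-trans m<∣a-b∣ (∣m-n∣≤m⊔n a b)))

  module Ranked {n} (T : Tournament n) (P : Fin n → ℕ)
                (P-injective : ∀ {x y} → P x ≡ P y → x ≡ y) where
    open Tournament T renaming (arc to G)

    arc⇒≢ : ∀ {x y} → G x y ≡ true → x ≢ y
    arc⇒≢ {x} Gxy refl with () ← trans (sym Gxy) (loopless x)

    arc-asym : ∀ {x y} → G x y ≡ true → G y x ≡ true → ⊥
    arc-asym {x} {y} Gxy Gyx with () ← trans (sym Gyx) (antisym x y Gxy)

    forwardIn backIn backOut : Fin n → ℕ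
    forwardIn v = ∑[ u < n ] ⟦ G u v ∧ ⌊ P u <? P v ⌋ ⟧
    backIn    v = ∑[ u < n ] ⟦ G u v ∧ ⌊ P v <? P u ⌋ ⟧
    backOut   v = ∑[ u < n ] ⟦ G v u ∧ ⌊ P u <? P v ⌋ ⟧

    indeg≡forwardIn+backIn : ∀ v → indeg G v ≡ forwardIn v + backIn v
    indeg≡forwardIn+backIn v =
      trans (count≡sum (λ u → G u v))
            (trans (sum-cong-≗ split) (∑-distrib-+ before after))
      where
      before after : Fin n → ℕ
      before u = ⟦ G u v ∧ ⌊ P u <? P v ⌋ ⟧
      after  u = ⟦ G u v ∧ ⌊ P v <? P u ⌋ ⟧
      split : ∀ u → ⟦ G u v ⟧ ≡ ⟦ G u v ∧ ⌊ P u <? P v ⌋ ⟧ + ⟦ G u v ∧ ⌊ P v <? P u ⌋ ⟧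
      split u with G u v in Guv
      ... | false = refl
      ... | true  = sym (⟦<⟧+⟦>⟧≡1 (arc⇒≢ Guv ∘ P-injective))

    earlier≡forwardIn+backOut : ∀ v → ∑[ u < n ] ⟦ ⌊ P u <? P v ⌋ ⟧ ≡ forwardIn v + backOut v
    earlier≡forwardIn+backOut v =
      trans (sum-cong-≗ split) (∑-distrib-+ into outOf)
      where
      into outOf : Fin n → ℕ
      into  u = ⟦ G u v ∧ ⌊ P u <? P v ⌋ ⟧
      outOf u = ⟦ G v u ∧ ⌊ P u <? P v ⌋ ⟧
      split : ∀ u → ⟦ ⌊ P u <? P v ⌋ ⟧ ≡ ⟦ G u v ∧ ⌊ P u <? P v ⌋ ⟧ + ⟦ G v u ∧ ⌊ P u <? P v ⌋ ⟧
      split u with P u <? P v | G u v in Guv | G v u in Gvu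
      ... | no _    | a     | b     = sym (cong₂ _+_ (cong ⟦_⟧ (∧-zeroʳ a)) (cong ⟦_⟧ (∧-zeroʳ b)))
      ... | yes _   | true  | true  with () ← trans (sym Gvu) (antisym u v Guv)
      ... | yes _   | true  | false = refl
      ... | yes _   | false | true  = refl
      ... | yes u<v | false | false with total u v (λ { refl → <-irrefl refl u<v })
      ...   | inj₁ Guv′ with () ← trans (sym Guv′) Guv
      ...   | inj₂ Gvu′ with () ← trans (sym Gvu′) Gvu

    -- Moving one vertex behind another

    module MoveBehind (v : Fin n) where

      laterIn : Fin n → Bool
      laterIn u = G u v ∧ ⌊ P v <? P u ⌋

      laterInUpTo laterOutUpTo : Fin n → Fin n → Bool
      laterInUpTo  u w = laterIn w ∧ ⌊ P w ≤? P u ⌋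
      laterOutUpTo u w = G v w ∧ ⌊ P v <? P w ⌋ ∧ ⌊ P w ≤? P u ⌋

      repaired broken : Fin n → ℕ
      repaired u = ∑[ w < n ] ⟦ laterInUpTo u w ⟧
      broken   u = ∑[ w < n ] ⟦ laterOutUpTo u w ⟧

      -- v is moved just behind u; doubling the other ranks makes room for it.
      movedBehind : Fin n → Fin n → ℕ
      movedBehind u x = if ⌊ x ≟ v ⌋ then suc (2 * P u) else 2 * P x

      exchange-pointwise : ∀ {u} → P v ≤ P u → ∀ x y →
        ⟦ backArcs G P x y ⟧ + ⟦ ⌊ x ≟ v ⌋ ∧ laterOutUpTo u y ⟧ ≡
        ⟦ backArcs G (movedBehind u) x y ⟧ + ⟦ ⌊ y ≟ v ⌋ ∧ laterInUpTo u x ⟧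
      exchange-pointwise {u} pv≤pu x y with x ≟ v | y ≟ v
      ... | yes refl | yes refl rewrite loopless v = refl
      ... | yes refl | no _ with G v y
      ...   | false = refl
      ...   | true  = begin
        ⟦ ⌊ P y ≤? P v ⌋ ⟧ + ⟦ ⌊ P v <? P y ⌋ ∧ ⌊ P y ≤? P u ⌋ ⟧
          ≡⟨ ⟦≤⟧+⟦between⟧ (P y) pv≤pu ⟩
        ⟦ ⌊ P y ≤? P u ⌋ ⟧
          ≡⟨ cong ⟦_⟧ (⌊2*≤1+2*⌋ (P y) (P u)) ⟨
        ⟦ ⌊ 2 * P y ≤? suc (2 * P u) ⌋ ⟧
          ≡⟨ +-identityʳ _ ⟨
        ⟦ ⌊ 2 * P y ≤? suc (2 * P u) ⌋ ⟧ + 0 ∎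
        where open ≡-Reasoning
      exchange-pointwise {u} pv≤pu x y | no x≢v | yes refl with G x v
      ...   | false = refl
      ...   | true  = begin
        ⟦ ⌊ P v ≤? P x ⌋ ⟧ + 0
          ≡⟨ +-identityʳ _ ⟩
        ⟦ ⌊ P v ≤? P x ⌋ ⟧
          ≡⟨ ⟦≤⟧≡⟦>⟧+⟦between⟧ (P x) (x≢v ∘ P-injective) pv≤pu ⟩
        ⟦ ⌊ P u <? P x ⌋ ⟧ + between
          ≡⟨ cong (λ c → ⟦ c ⟧ + between) (⌊1+2*≤2*⌋ (P u) (P x)) ⟨
        ⟦ ⌊ suc (2 * P u) ≤? 2 * P x ⌋ ⟧ + between ∎
        where
        open ≡-Reasoning
        between : ℕ
        between = ⟦ ⌊ P v <? P x ⌋ ∧ ⌊ P x ≤? P u ⌋ ⟧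
      exchange-pointwise {u} pv≤pu x y | no _ | no _ =
        cong (λ c → ⟦ G x y ∧ c ⟧ + 0) (sym (⌊2*≤2*⌋ (P y) (P x)))

      exchange : ∀ {u} → P v ≤ P u →
        count₂ (backArcs G P) + broken u ≡ count₂ (backArcs G (movedBehind u)) + repaired u
      exchange {u} pv≤pu = begin
        count₂ (backArcs G P) + broken u
          ≡⟨ cong₂ _+_ (count₂≡sum₂ (backArcs G P)) (sym (sum₂-δ-row (laterOutUpTo u) v)) ⟩
        sum₂ before + sum₂ breaking
          ≡⟨ sum₂-distrib-+ before breaking ⟨
        sum₂ (λ x y → before x y + breaking x y)
          ≡⟨ sum-cong-≗ (λ x → sum-cong-≗ (exchange-pointwise pv≤pu x)) ⟩
        sum₂ (λ x y → after x y + repairing x y)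
          ≡⟨ sum₂-distrib-+ after repairing ⟩
        sum₂ after + sum₂ repairing
          ≡⟨ cong₂ _+_ (sym (count₂≡sum₂ (backArcs G (movedBehind u))))
                       (sum₂-δ-column (laterInUpTo u) v) ⟩
        count₂ (backArcs G (movedBehind u)) + repaired u ∎
        where
        open ≡-Reasoning
        before after breaking repairing : Fin n → Fin n → ℕ
        before    x y = ⟦ backArcs G P x y ⟧
        after     x y = ⟦ backArcs G (movedBehind u) x y ⟧
        breaking  x y = ⟦ ⌊ x ≟ v ⌋ ∧ laterOutUpTo u y ⟧
        repairing x y = ⟦ ⌊ y ≟ v ⌋ ∧ laterInUpTo u x ⟧

      otherBackOut : Fin n → ℕ
      otherBackOut u = ∑[ w < n ] ⟦ backArcs G P u w ∧ not ⌊ w ≟ v ⌋ ⟧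

      broken≤triangles+otherBackOut : ∀ {u} → G u v ≡ true →
        broken u ≤ triangles G u v + otherBackOut u
      broken≤triangles+otherBackOut {u} Guv = begin
        broken u
          ≤⟨ sum-mono-≤ (λ w → ⟦⟧-mono-⊎ (triangle-or-back w)) ⟩
        ∑[ w < n ] (triangle w + otherBack w)
          ≡⟨ ∑-distrib-+ triangle otherBack ⟩
        sum triangle + otherBackOut u
          ≡⟨ cong (_+ otherBackOut u) (count≡sum (λ w → G v w ∧ G w u)) ⟨
        triangles G u v + otherBackOut u ∎
        where
        open ≤-Reasoning
        triangle otherBack : Fin n → ℕ
        triangle  w = ⟦ G v w ∧ G w u ⟧
        otherBack w = ⟦ backArcs G P u w ∧ not ⌊ w ≟ v ⌋ ⟧
        triangle-or-back : ∀ w → laterOutUpTo u w ≡ true →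
          G v w ∧ G w u ≡ true ⊎ backArcs G P u w ∧ not ⌊ w ≟ v ⌋ ≡ true
        triangle-or-back w out with G v w in Gvw | G w u in Gwu
        ... | true  | true  = inj₁ refl
        ... | true  | false with total u w (λ { refl → arc-asym Guv Gvw })
        ...   | inj₂ Gwu′ with () ← trans (sym Gwu′) Gwu
        ...   | inj₁ Guw
          rewrite Guw | ⌊⌋-true (P w ≤? P u) (⌊⌋-sound (P w ≤? P u) (∧-conicalʳ _ _ out))
                | ⌊⌋-false (w ≟ v) (arc⇒≢ Gvw ∘ sym) = inj₂ refl

      repaired≤backIn : ∀ u → repaired u ≤ backIn v
      repaired≤backIn u =
        sum-mono-≤ {f = λ w → ⟦ laterInUpTo u w ⟧} (λ w → ⟦⟧-mono (∧-conicalˡ (laterIn w) _))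

      suspect : ℕ → Fin n → Bool
      suspect e u = laterIn u ∧ ⌊ suc e ≤? triangles G u v ⌋

      suspect⇒arc : ∀ {e u} → suspect e u ≡ true → G u v ≡ true
      suspect⇒arc {e} {u} susp = ∧-conicalˡ (G u v) _ (∧-conicalˡ (laterIn u) _ susp)

      suspect⇒triangles : ∀ {e u} → suspect e u ≡ true → suc e ≤ triangles G u v
      suspect⇒triangles {e} {u} susp =
        ⌊⌋-sound (suc e ≤? triangles G u v) (∧-conicalʳ (laterIn u) _ susp)

      laterIn⇒backArc : ∀ {u} → laterIn u ≡ true → backArcs G P u v ≡ true
      laterIn⇒backArc {u} later
        rewrite ⌊⌋-true (P v ≤? P u) (<⇒≤ (⌊⌋-sound (P v <? P u) (∧-conicalʳ (G u v) _ later)))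
              | ∧-conicalˡ (G u v) _ later = refl

      otherBackOut+backIn≤back :
        ∑[ u < n ] (⟦ laterIn u ⟧ * otherBackOut u) + backIn v ≤ count₂ (backArcs G P)
      otherBackOut+backIn≤back = begin
        sum other + backIn v                            ≡⟨ ∑-distrib-+ other (λ u → ⟦ laterIn u ⟧) ⟨
        ∑[ u < n ] (other u + ⟦ laterIn u ⟧)           ≤⟨ sum-mono-≤ row ⟩
        sum₂ (λ u w → ⟦ backArcs G P u w ⟧)            ≡⟨ count₂≡sum₂ (backArcs G P) ⟨
        count₂ (backArcs G P)                           ∎
        where
        open ≤-Reasoning
        other : Fin n → ℕ
        other u = ⟦ laterIn u ⟧ * otherBackOut u
        row : ∀ u → other u + ⟦ laterIn u ⟧ ≤ ∑[ w < n ] ⟦ backArcs G P u w ⟧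
        row u with laterIn u in later
        ... | false = z≤n
        ... | true
          rewrite *-identityˡ (otherBackOut u) | sum-remove-one (backArcs G P u) v | laterIn⇒backArc later = ≤-refl

      module _ {k} (back≤k : count₂ (backArcs G P) ≤ k)
                   (k≤back : ∀ r → k ≤ count₂ (backArcs G r)) where

        repaired≤broken : ∀ {u} → P v ≤ P u → repaired u ≤ broken u
        repaired≤broken {u} pv≤pu = +-cancelˡ-≤ (count₂ (backArcs G (movedBehind u))) _ _ (begin
          count₂ (backArcs G (movedBehind u)) + repaired u ≡⟨ exchange pv≤pu ⟨
          count₂ (backArcs G P) + broken u
            ≤⟨ +-monoˡ-≤ (broken u) (≤-trans back≤k (k≤back (movedBehind u))) ⟩
          count₂ (backArcs G (movedBehind u)) + broken u   ∎)
          where open ≤-Reasoning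

        module _ (e : ℕ) where

          repaired-bound : ∀ u → ⟦ laterIn u ⟧ * repaired u + ⟦ suspect e u ⟧ * e ≤
            ⟦ suspect e u ⟧ * backIn v + ⟦ laterIn u ⟧ * e + ⟦ laterIn u ⟧ * otherBackOut u
          repaired-bound u with laterIn u in later
          ... | false = z≤n
          ... | true with suc e ≤? triangles G u v
          ...   | yes _
            rewrite *-identityˡ (repaired u) | *-identityˡ e | *-identityˡ (backIn v)
                  | *-identityˡ (otherBackOut u) =
              ≤-trans (+-monoˡ-≤ e (repaired≤backIn u)) (m≤m+n _ _)
          ...   | no few
            rewrite *-identityˡ (repaired u) | *-identityˡ e | *-identityˡ (otherBackOut u)
                  | +-identityʳ (repaired u) = begin
              repaired u
                ≤⟨ repaired≤broken (<⇒≤ (⌊⌋-sound (P v <? P u) (∧-conicalʳ _ _ later))) ⟩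
              broken u                         ≤⟨ broken≤triangles+otherBackOut (∧-conicalˡ _ _ later) ⟩
              triangles G u v + otherBackOut u ≤⟨ +-monoˡ-≤ (otherBackOut u) (≤-pred (≰⇒> few)) ⟩
              e + otherBackOut u               ∎
            where open ≤-Reasoning

          repaired-total :
            ∑[ u < n ] (⟦ laterIn u ⟧ * repaired u) + ∑[ u < n ] ⟦ suspect e u ⟧ * e ≤
            ∑[ u < n ] ⟦ suspect e u ⟧ * backIn v + backIn v * e
              + ∑[ u < n ] (⟦ laterIn u ⟧ * otherBackOut u)
          repaired-total = begin
            sum rep + sum susp * e          ≡⟨ cong (sum rep +_) (*-distribʳ-sum e susp) ⟩
            sum rep + sum (λ u → susp u * e) ≡⟨ ∑-distrib-+ rep (λ u → susp u * e) ⟨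
            ∑[ u < n ] (rep u + susp u * e)  ≤⟨ sum-mono-≤ repaired-bound ⟩
            ∑[ u < n ] (susp u * backIn v + later u * e + other u)
              ≡⟨ ∑-distrib-+ (λ u → susp u * backIn v + later u * e) other ⟩
            ∑[ u < n ] (susp u * backIn v + later u * e) + sum other
              ≡⟨ cong (_+ sum other) (∑-distrib-+ (λ u → susp u * backIn v) (λ u → later u * e)) ⟩
            sum (λ u → susp u * backIn v) + sum (λ u → later u * e) + sum other
              ≡⟨ cong (_+ sum other)
                      (cong₂ _+_ (*-distribʳ-sum (backIn v) susp) (*-distribʳ-sum e later)) ⟨
            sum susp * backIn v + backIn v * e + sum other ∎
            where
            open ≤-Reasoning
            later susp rep other : Fin n → ℕ
            later u = ⟦ laterIn u ⟧
            susp  u = ⟦ suspect e u ⟧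
            rep   u = ⟦ laterIn u ⟧ * repaired u
            other u = ⟦ laterIn u ⟧ * otherBackOut u

          many-suspects : k ≤ suc e * suc e → 4 * e < backIn v → e < ∑[ u < n ] ⟦ suspect e u ⟧
          many-suspects k≤ 4e<backIn =
            suspects-exceed (sum-ordered-pairs laterIn P P-injective) repaired-total
                            (≤-trans otherBackOut+backIn≤back (≤-trans back≤k k≤)) 4e<backIn

  position : ∀ {n} → Ordering n → Fin n → ℕ
  position π v = toℕ (π ⟨$⟩ʳ v)

  position-injective : ∀ {n} (π : Ordering n) {x y} → position π x ≡ position π y → x ≡ y
  position-injective π {x} {y} eq = begin
    x                        ≡⟨ inverseˡ π ⟨
    π ⟨$⟩ˡ (π ⟨$⟩ʳ x)        ≡⟨ cong (π ⟨$⟩ˡ_) (Fin.toℕ-injective eq) ⟩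
    π ⟨$⟩ˡ (π ⟨$⟩ʳ y)        ≡⟨ inverseˡ π ⟩
    y                        ∎
    where open ≡-Reasoning

  count-toℕ< : ∀ {n m} → m ≤ n → ∑[ i < n ] ⟦ ⌊ toℕ i <? m ⌋ ⟧ ≡ m
  count-toℕ< {zero}  z≤n       = refl
  count-toℕ< {suc n} {zero}  _ =
    sum-zero {suc n} {λ i → ⟦ ⌊ toℕ i <? 0 ⌋ ⟧} λ i → cong ⟦_⟧ (⌊⌋-false (toℕ i <? 0) λ ())
  count-toℕ< {suc n} {suc m} (s≤s m≤n) = cong suc (begin
    ∑[ i < n ] ⟦ ⌊ suc (toℕ i) <? suc m ⌋ ⟧
      ≡⟨ sum-cong-≗ {n} (λ i → cong ⟦_⟧ (⌊⌋-⇔ (suc (toℕ i) <? suc m) (toℕ i <? m) s≤s⁻¹ s≤s)) ⟩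
    ∑[ i < n ] ⟦ ⌊ toℕ i <? m ⌋ ⟧
      ≡⟨ count-toℕ< m≤n ⟩
    m ∎)
    where open ≡-Reasoning

  earlier≡position : ∀ {n} (π : Ordering n) v →
    ∑[ u < n ] ⟦ ⌊ position π u <? position π v ⌋ ⟧ ≡ position π v
  earlier≡position π v =
    trans (sym (∑-permute (λ i → ⟦ ⌊ toℕ i <? position π v ⌋ ⟧) π)) (count-toℕ< (<⇒≤ (Fin.toℕ<n _)))

  reverse : ∀ {n} → Tournament n → Tournament n
  reverse T = record
    { arc      = λ x y → arc y x
    ; loopless = loopless
    ; total    = λ u v u≢v → swap (total u v u≢v)
    ; antisym  = λ u v → antisym v u
    }
    where open Tournament T

  triangles-reverse : ∀ {n} (T : Tournament n) u v →
    triangles (Tournament.arc (reverse T)) u v ≡ triangles (Tournament.arc T) v u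
  triangles-reverse T u v =
    trans (count≡sum (λ w → G w v ∧ G u w))
          (trans (sum-cong-≗ λ w → cong ⟦_⟧ (∧-comm (G w v) (G u w)))
                 (sym (count≡sum (λ w → G u w ∧ G w v))))
    where open Tournament T renaming (arc to G)

  majorSuspect-if-triangles : ∀ {n} (G : Digraph n) {t e} →
    (∀ {x} → suc e ≤ x → t ℚ.≤ ℕtoℚ x) →
    ∀ {u v} → G u v ≡ true → suc e ≤ triangles G u v → majorSuspect G t u v ≡ true
  majorSuspect-if-triangles G t≤ Guv 1+e≤tri rewrite Guv = Equivalence.to T-≡ (ℚ.≤⇒≤ᵇ (t≤ 1+e≤tri))

  module _ {n} (T : Tournament n) (π : Ordering n) {k}
           (min : MinFASSize (Tournament.arc T) k)
           (back≡k : backwardCount (Tournament.arc T) π ≡ k) where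
    open Tournament T renaming (arc to G)

    private
      P P′ : Fin n → ℕ
      P    = position π
      P′ x = n ∸ P x

      P≤n : ∀ x → P x ≤ n
      P≤n x = <⇒≤ (Fin.toℕ<n (π ⟨$⟩ʳ x))

      P′-injective : ∀ {x y} → P′ x ≡ P′ y → x ≡ y
      P′-injective = position-injective π ∘ ∸-cancelˡ-≡ (P≤n _) (P≤n _)

      module Forward  = Ranked T P (position-injective π)
      module Backward = Ranked (reverse T) P′ P′-injective

    err≡∣backOut-backIn∣ : ∀ v → err G π v ≡ ∣ Forward.backOut v - Forward.backIn v ∣
    err≡∣backOut-backIn∣ v = begin
      ∣ P v - indeg G v ∣
        ≡⟨ cong₂ ∣_-_∣ (trans (sym (earlier≡position π v)) (Forward.earlier≡forwardIn+backOut v))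
                       (Forward.indeg≡forwardIn+backIn v) ⟩
      ∣ Forward.forwardIn v + Forward.backOut v - Forward.forwardIn v + Forward.backIn v ∣
        ≡⟨ ∣m+n-m+o∣≡∣n-o∣ (Forward.forwardIn v) (Forward.backOut v) (Forward.backIn v) ⟩
      ∣ Forward.backOut v - Forward.backIn v ∣ ∎
      where open ≡-Reasoning

    private
      backArc⇒backward : ∀ x y → backArcs G P x y ≡ true → G x y ∧ ⌊ P y <? P x ⌋ ≡ true
      backArc⇒backward x y back with G x y in Gxy
      ... | true = ⌊⌋-true (P y <? P x)
                     (≤∧≢⇒< (⌊⌋-sound (P y ≤? P x) back)
                            (Forward.arc⇒≢ Gxy ∘ sym ∘ position-injective π))

      reversedBackArc⇒backward : ∀ x y → backArcs (Tournament.arc (reverse T)) P′ x y ≡ true →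
        G y x ∧ ⌊ P x <? P y ⌋ ≡ true
      reversedBackArc⇒backward x y back with G y x in Gyx
      ... | true = ⌊⌋-true (P x <? P y)
                     (∸-reverse-≤ (P≤n x) (Forward.arc⇒≢ Gyx ∘ sym ∘ position-injective π)
                                  (⌊⌋-sound (P′ y ≤? P′ x) back))

    backArcs≤k : count₂ (backArcs G P) ≤ k
    backArcs≤k = subst (count₂ (backArcs G P) ≤_) back≡k (count₂-mono backArc⇒backward)

    reversedBackArcs≤k : count₂ (backArcs (Tournament.arc (reverse T)) P′) ≤ k
    reversedBackArcs≤k =
      subst (count₂ (backArcs (Tournament.arc (reverse T)) P′) ≤_)
            (trans (count₂-transpose backward) back≡k)
            (count₂-mono {F′ = λ x y → backward y x} reversedBackArc⇒backward)
      where
      backward : Fin n → Fin n → Bool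
      backward x y = G x y ∧ ⌊ P y <? P x ⌋

    k≤reversedBackArcs : ∀ r → k ≤ count₂ (backArcs (Tournament.arc (reverse T)) r)
    k≤reversedBackArcs r =
      subst (k ≤_) (sym (count₂-transpose (forwardArcs G r))) (minFAS≤forwardArcs min r)

    backOut≤reversedBackIn : ∀ v → Forward.backOut v ≤ Backward.backIn v
    backOut≤reversedBackIn v =
      sum-mono-≤ {f = λ u → ⟦ G v u ∧ ⌊ P u <? P v ⌋ ⟧} λ u → ⟦⟧-mono (reversed u)
      where
      reversed : ∀ u → G v u ∧ ⌊ P u <? P v ⌋ ≡ true → G v u ∧ ⌊ P′ v <? P′ u ⌋ ≡ true
      reversed u backOut with G v u
      ... | true = ⌊⌋-true (P′ v <? P′ u) (∸-monoʳ-< (⌊⌋-sound (P u <? P v) backOut) (P≤n v))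

    module _ {t e} (t≤ : ∀ {x} → suc e ≤ x → t ℚ.≤ ℕtoℚ x) (v : Fin n) where

      suspects≤suspectDeg : ∀ (S : Fin n → Bool) →
        (∀ {u} → S u ≡ true → majorSuspect G t v u ∨ majorSuspect G t u v ≡ true) →
        ∑[ u < n ] ⟦ S u ⟧ ≤ suspectDeg G t v
      suspects≤suspectDeg S major =
        subst (∑[ u < n ] ⟦ S u ⟧ ≤_)
              (sym (count≡sum (λ w → majorSuspect G t v w ∨ majorSuspect G t w v)))
              (sum-mono-≤ {f = λ u → ⟦ S u ⟧} λ u → ⟦⟧-mono major)

      private
        module F = Forward.MoveBehind v
        module B = Backward.MoveBehind v

      forwardSuspects≤suspectDeg : ∑[ u < n ] ⟦ F.suspect e u ⟧ ≤ suspectDeg G t v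
      forwardSuspects≤suspectDeg = suspects≤suspectDeg (F.suspect e) λ {u} susp →
        trans (cong (majorSuspect G t v u ∨_)
                    (majorSuspect-if-triangles G {t} {e} t≤ (F.suspect⇒arc susp) (F.suspect⇒triangles susp)))
              (∨-zeroʳ _)

      backwardSuspects≤suspectDeg : ∑[ u < n ] ⟦ B.suspect e u ⟧ ≤ suspectDeg G t v
      backwardSuspects≤suspectDeg = suspects≤suspectDeg (B.suspect e) λ {u} susp →
        cong (_∨ majorSuspect G t u v)
             (majorSuspect-if-triangles G {t} {e} t≤ (B.suspect⇒arc susp)
               (subst (suc e ≤_) (triangles-reverse T u v) (B.suspect⇒triangles susp)))

      suspectDeg-large : k ≤ suc e * suc e → 4 * e < err G π v → e < suspectDeg G t v
      suspectDeg-large k≤ 4e<err with <∣-∣⇒<⊎< (subst (4 * e <_) (err≡∣backOut-backIn∣ v) 4e<err)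
      ... | inj₁ 4e<backOut = <-≤-trans
        (B.many-suspects reversedBackArcs≤k k≤reversedBackArcs e k≤
                         (<-≤-trans 4e<backOut (backOut≤reversedBackIn v)))
        backwardSuspects≤suspectDeg
      ... | inj₂ 4e<backIn = <-≤-trans
        (F.many-suspects backArcs≤k (minFAS≤backArcs min) e k≤ 4e<backIn)
        forwardSuspects≤suspectDeg

      bad-if-large-error : k ≤ suc e * suc e → 4 * e < err G π v → Bad G t v
      bad-if-large-error k≤ 4e<err = t≤ (suspectDeg-large k≤ 4e<err)

open Counting using (bad-if-large-error)

open import Data.Nat using (ℕ; suc; s≤s; _+_)
import Data.Nat as ℕ
import Data.Nat.Properties as ℕ
open import Data.Nat.DivMod using (_/_; _%_; m/n*n≤m; m≡m%n+[m/n]*n; m%n<n)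
import Data.Nat.Coprimality as Coprime
open import Data.Fin using (Fin)
open import Data.Integer using (+_; +0; -[1+_]; +≤+; +<+)
import Data.Integer as ℤ
import Data.Integer.Properties as ℤ
open import Data.Rational using (ℚ; mkℚ; toℚᵘ; 0ℚ; _<_; _≤_; _*_; *≤*; *<*; positive; nonNegative)
open import Data.Rational.Properties
  using ( module ≤-Reasoning; pos⇒nonNeg; normalize-coprime; drop-*≤*; drop-*<*; ≤-trans
        ; toℚᵘ-injective; toℚᵘ-homo-*; *-monoʳ-≤-nonNeg; *-monoˡ-≤-nonNeg; *-monoʳ-<-pos)
import Data.Rational.Unnormalised as ℚᵘ
import Data.Rational.Unnormalised.Properties as ℚᵘ
open import Data.Product using (∃; _×_; _,_; proj₁; proj₂)
open import Relation.Binary.PropositionalEquality using (_≡_; sym; trans; cong; subst₂)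

ℕtoℚ≡mkℚ : ∀ n → ℕtoℚ n ≡ mkℚ (+ n) 0 (Coprime.sym (Coprime.1-coprimeTo n))
ℕtoℚ≡mkℚ n = normalize-coprime _

ℕtoℚ-mono-≤ : ∀ {m n} → m ℕ.≤ n → ℕtoℚ m ≤ ℕtoℚ n
ℕtoℚ-mono-≤ {m} {n} m≤n rewrite ℕtoℚ≡mkℚ m | ℕtoℚ≡mkℚ n =
  *≤* (ℤ.*-monoʳ-≤-nonNeg (+ 1) (+≤+ m≤n))

ℕtoℚ-cancel-≤ : ∀ {m n} → ℕtoℚ m ≤ ℕtoℚ n → m ℕ.≤ n
ℕtoℚ-cancel-≤ {m} {n} m≤n rewrite ℕtoℚ≡mkℚ m | ℕtoℚ≡mkℚ n =
  ℤ.drop‿+≤+ (subst₂ ℤ._≤_ (ℤ.*-identityʳ (+ m)) (ℤ.*-identityʳ (+ n)) (drop-*≤* m≤n))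

ℕtoℚ-cancel-< : ∀ {m n} → ℕtoℚ m < ℕtoℚ n → m ℕ.< n
ℕtoℚ-cancel-< {m} {n} m<n rewrite ℕtoℚ≡mkℚ m | ℕtoℚ≡mkℚ n =
  ℤ.drop‿+<+ (subst₂ ℤ._<_ (ℤ.*-identityʳ (+ m)) (ℤ.*-identityʳ (+ n)) (drop-*<* m<n))

ℕtoℚ-homo-* : ∀ m n → ℕtoℚ (m ℕ.* n) ≡ ℕtoℚ m * ℕtoℚ n
ℕtoℚ-homo-* m n =
  toℚᵘ-injective (ℚᵘ.≃-trans embed (ℚᵘ.≃-sym (toℚᵘ-homo-* (ℕtoℚ m) (ℕtoℚ n))))
  where
  embed : toℚᵘ (ℕtoℚ (m ℕ.* n)) ℚᵘ.≃ toℚᵘ (ℕtoℚ m) ℚᵘ.* toℚᵘ (ℕtoℚ n)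
  embed rewrite ℕtoℚ≡mkℚ (m ℕ.* n) | ℕtoℚ≡mkℚ m | ℕtoℚ≡mkℚ n =
    ℚᵘ.*≡* (cong (ℤ._* + 1) (ℤ.pos-* m n))

ℕtoℚ-bracket : ∀ t → 0ℚ < t → ∃ λ e → ℕtoℚ e < t × t ≤ ℕtoℚ (suc e)
ℕtoℚ-bracket (mkℚ +0         _ _) (*<* (+<+ ()))
ℕtoℚ-bracket (mkℚ -[1+ _ ]   _ _) (*<* ())
ℕtoℚ-bracket (mkℚ (+ suc N) d-1 _) _ = e , below , above
  where
  D e : ℕ
  D = suc d-1
  e = N / D
  below : ℕtoℚ e < mkℚ (+ suc N) d-1 _
  below rewrite ℕtoℚ≡mkℚ e =
    *<* (subst₂ ℤ._<_ (ℤ.pos-* e D) (sym (ℤ.*-identityʳ (+ suc N))) (+<+ (s≤s (m/n*n≤m N D))))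
  above : mkℚ (+ suc N) d-1 _ ≤ ℕtoℚ (suc e)
  above rewrite ℕtoℚ≡mkℚ (suc e) =
    *≤* (subst₂ ℤ._≤_ (sym (ℤ.*-identityʳ (+ suc N))) (ℤ.pos-* (suc e) D) (+≤+ (begin
      suc N                   ≡⟨ cong suc (m≡m%n+[m/n]*n N D) ⟩
      suc (N % D + e ℕ.* D)   ≤⟨ ℕ.+-monoˡ-≤ (e ℕ.* D) (m%n<n N D) ⟩
      D + e ℕ.* D             ∎)))
    where open ℕ.≤-Reasoning

module Ceiling {t} (0<t : 0ℚ < t) where

  e : ℕ
  e = proj₁ (ℕtoℚ-bracket t 0<t)

  e<t : ℕtoℚ e < t
  e<t = proj₁ (proj₂ (ℕtoℚ-bracket t 0<t))

  t≤1+e : t ≤ ℕtoℚ (suc e)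
  t≤1+e = proj₂ (proj₂ (ℕtoℚ-bracket t 0<t))

  t≤ℕtoℚ : ∀ {x} → suc e ℕ.≤ x → t ≤ ℕtoℚ x
  t≤ℕtoℚ 1+e≤x = ≤-trans t≤1+e (ℕtoℚ-mono-≤ 1+e≤x)

  ℕtoℚ≤t*t⇒≤[1+e]² : ∀ {k} → ℕtoℚ k ≤ t * t → k ℕ.≤ suc e ℕ.* suc e
  ℕtoℚ≤t*t⇒≤[1+e]² {k} k≤t*t = ℕtoℚ-cancel-≤ (begin
    ℕtoℚ k                        ≤⟨ k≤t*t ⟩
    t * t                         ≤⟨ *-monoʳ-≤-nonNeg t {{pos⇒nonNeg t {{positive 0<t}}}} t≤1+e ⟩
    ℕtoℚ (suc e) * t              ≤⟨ *-monoˡ-≤-nonNeg (ℕtoℚ (suc e)) {{nonNegative 0≤1+e}} t≤1+e ⟩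
    ℕtoℚ (suc e) * ℕtoℚ (suc e)   ≡⟨ ℕtoℚ-homo-* (suc e) (suc e) ⟨
    ℕtoℚ (suc e ℕ.* suc e)        ∎)
    where
    open ≤-Reasoning
    0≤1+e : 0ℚ ≤ ℕtoℚ (suc e)
    0≤1+e = ℕtoℚ-mono-≤ {0} {suc e} ℕ.z≤n

  4t≤d<x⇒4e<x : ∀ {d x} → ℕtoℚ 4 * t ≤ d → d < ℕtoℚ x → 4 ℕ.* e ℕ.< x
  4t≤d<x⇒4e<x {d} {x} 4t≤d d<x = ℕtoℚ-cancel-< (begin-strict
    ℕtoℚ (4 ℕ.* e)    ≡⟨ ℕtoℚ-homo-* 4 e ⟩
    ℕtoℚ 4 * ℕtoℚ e   <⟨ *-monoʳ-<-pos (ℕtoℚ 4) e<t ⟩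
    ℕtoℚ 4 * t        ≤⟨ 4t≤d ⟩
    d                 <⟨ d<x ⟩
    ℕtoℚ x            ∎)
    where open ≤-Reasoning

lemma1 : ∀ (n k : ℕ) (T : Tournament n) (π : Ordering n) (t d : ℚ)
    → MinFASSize (Tournament.arc T) k
    → backwardCount (Tournament.arc T) π ≡ k
    → 0ℚ < t → 0ℚ < d
    → ℕtoℚ 4 * t ≤ d
    → ℕtoℚ k ≤ t * t
    → ∀ (v : Fin n) → d < ℕtoℚ (err (Tournament.arc T) π v)
    → Bad (Tournament.arc T) t v
lemma1 n k T π t d min back≡k 0<t _ 4t≤d k≤t*t v d<err =
  bad-if-large-error T π min back≡k {t} {e} t≤ℕtoℚ v
    (ℕtoℚ≤t*t⇒≤[1+e]² k≤t*t) (4t≤d<x⇒4e<x 4t≤d d<err)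
  where open Ceiling 0<t
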